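{- Let $\mathbf A\in\mathcal S$ satisfy $x\to x\approx x$. Then $\mathbf A$ satisfies $x'\approx x$.
   Context: A zroupoid is an algebra $\langle A,\to,0\rangle$ with $\to$ binary and $0$ a constant; write $x' := x\to 0$. An implication zroupoid ($\mathcal I$-zroupoid) is a zroupoid satisfying (I) $(x\to y)\to z \approx ((z'\to x)\to(y\to z)')'$ and (I$_0$) $0''\approx 0$. $\mathcal S$ is the variety of $\mathcal I$-zroupoids satisfying $x''\approx x$ and $(x\to y')'\approx (y\to x')'$. -}

module Defs where

open import Level using (Level; suc)
open import Relation.Binary.PropositionalEquality using (_≡_)

record Zroupoid (a : Level) : Set (suc a) where
  infixr 5 _⇒_
  field
    Carrier : Set a
    _⇒_     : Carrier → Carrier → Carrier
    𝟎       : Carrier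

  _′ : Carrier → Carrier
  x ′ = x ⇒ 𝟎

module _ {a : Level} (A : Zroupoid a) where
  open Zroupoid A

  IsIZroupoid : Set a
  IsIZroupoid =
    (∀ x y z → (x ⇒ y) ⇒ z ≡ (((z ′) ⇒ x) ⇒ ((y ⇒ z) ′)) ′)
    × ((𝟎 ′) ′ ≡ 𝟎)
    where open import Data.Product using (_×_)

  InS : Set a
  InS = IsIZroupoid
      × (∀ x → (x ′) ′ ≡ x)
      × (∀ x y → (x ⇒ (y ′)) ′ ≡ (y ⇒ (x ′)) ′)
    where open import Data.Product using (_×_)

-- Only two of the defining laws of 𝒮 are needed: the involution law
-- x″ ≈ x and the exchange law (x → y′)′ ≈ (y → x′)′.  Together they give,
-- for an arbitrary zroupoid, the identity x′ → x′ ≈ x → x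
-- (lemma  complement-square): instantiating the exchange law at y := x′
-- yields (x → x″)′ ≈ (x′ → x′)′, and the involution law removes the outer
-- complements and the double complement x″.  Under idempotency both sides
-- collapse, so x′ ≈ x′ → x′ ≈ x → x ≈ x.
module Submission where

open import Defs
open import Level using (Level)
open import Relation.Binary.PropositionalEquality using (_≡_; cong; module ≡-Reasoning)
open import Data.Product using (_,_)

module _ {a : Level} (A : Zroupoid a) where
  open Zroupoid A
  open ≡-Reasoning

  complement-square :
      (∀ x → (x ′) ′ ≡ x)
    → (∀ x y → (x ⇒ (y ′)) ′ ≡ (y ⇒ (x ′)) ′)
    → ∀ x → (x ′) ⇒ (x ′) ≡ x ⇒ x
  complement-square involutive exchange x = begin
    (x ′) ⇒ (x ′)              ≡⟨ involutive ((x ′) ⇒ (x ′)) ⟨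
    (((x ′) ⇒ (x ′)) ′) ′      ≡⟨ cong _′ (exchange x (x ′)) ⟨
    ((x ⇒ ((x ′) ′)) ′) ′      ≡⟨ involutive (x ⇒ ((x ′) ′)) ⟩
    x ⇒ ((x ′) ′)              ≡⟨ cong (x ⇒_) (involutive x) ⟩
    x ⇒ x                      ∎

lemma3p2 : {a : Level} (A : Zroupoid a) → InS A
    → (∀ x → Zroupoid._⇒_ A x x ≡ x)
    → ∀ x → Zroupoid._′ A x ≡ x
lemma3p2 A (_ , involutive , exchange) idempotent x = begin
  x ′                  ≡⟨ idempotent (x ′) ⟨
  (x ′) ⇒ (x ′)        ≡⟨ complement-square A involutive exchange x ⟩
  x ⇒ x                ≡⟨ idempotent x ⟩
  x                    ∎
  where
  open Zroupoid A
  open ≡-Reasoning
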